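{- For every integer $n\ge 2$, the minimum size of a guarding set of the complete graph $K_n$ is $n-1$.
   Context: An acyclic orientation of a graph $G=(V,E)$ is an orientation of each edge such that the resulting directed graph has no directed cycle. An edge $e$ is flippable in an acyclic orientation if reversing the orientation of $e$ alone yields again an acyclic orientation. A subset $S\subseteq E$ is a guarding set for $G$ if for every acyclic orientation of $G$ there exists an edge $e\in S$ that is flippable in that orientation. -}

module Defs where

open import Data.Nat using (ℕ)
open import Data.Fin using (Fin; _<_; _≟_)
open import Data.Bool using (Bool; true; false; not)
open import Data.Product using (Σ; _×_; _,_; proj₁; proj₂; Σ-syntax)
open import Data.List using (List; length)
open import Data.List.Relation.Unary.Any using (Any)
open import Data.List.Relation.Unary.Unique.Propositional using (Unique)
open import Relation.Binary.PropositionalEquality using (_≡_)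
open import Relation.Nullary using (¬_; yes; no)

-- The complete graph K_n on vertex set Fin n.
-- An edge {i,j} is represented uniquely as an ordered pair (i , j) with i < j.
Edge : ℕ → Set
Edge n = Σ[ p ∈ Fin n × Fin n ] (proj₁ p < proj₂ p)

-- An orientation of K_n: for each edge (i , j) with i < j,
-- true means the arc i → j, false means the arc j → i.
Orientation : ℕ → Set
Orientation n = Edge n → Bool

data Arc {n : ℕ} (o : Orientation n) : Fin n → Fin n → Set where
  fwd : (i j : Fin n) (p : i < j) → o ((i , j) , p) ≡ true  → Arc o i j
  bwd : (i j : Fin n) (p : i < j) → o ((i , j) , p) ≡ false → Arc o j i

data Walk {n : ℕ} (o : Orientation n) : Fin n → Fin n → Set where
  one  : {u v : Fin n} → Arc o u v → Walk o u v
  step : {u w v : Fin n} → Arc o u w → Walk o w v → Walk o u v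

Acyclic : {n : ℕ} → Orientation n → Set
Acyclic {n} o = (v : Fin n) → ¬ Walk o v v

flipEdge : {n : ℕ} → Orientation n → Edge n → Orientation n
flipEdge o ((i , j) , _) e'@((i' , j') , _) with i' ≟ i | j' ≟ j
... | yes _ | yes _ = not (o e')
... | _     | _     = o e'

Flippable : {n : ℕ} → Orientation n → Edge n → Set
Flippable o e = Acyclic (flipEdge o e)

Guarding : {n : ℕ} → List (Edge n) → Set
Guarding {n} S = (o : Orientation n) → Acyclic o → Any (Flippable o) S

MinGuardingSize : ℕ → ℕ → Set
MinGuardingSize n k =
  (Σ[ S ∈ List (Edge n) ] (Unique S × Guarding S × length S ≡ k))
  × ((S : List (Edge n)) → Unique S → Guarding S → k Data.Nat.≤ length S)

module Submission where

-- Both bounds rest on potentials: functions on the vertices that increase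
-- along every arc. A potential certifies acyclicity, and for an arc a → b of
-- an orientation of K_n with a potential it decides flippability: if some
-- vertex has potential strictly between those of a and b, the flip closes a
-- directed triangle (`between⇒not-flippable`); if none does, the flipped
-- orientation again has a potential (`adjacent⇒flippable`).
--
-- Upper bound: in an acyclic orientation the number of in-neighbours (the
-- rank) is a potential, and the neighbour of vertex 0 with rank closest to
-- that of 0 spans a flippable edge of the star at 0 (`star-guarding`).
-- Lower bound: if |S| ≤ n - 2, the vertices can be listed so that no edge of
-- S joins two consecutive ones (`Arrangement.arrange`, by induction removing
-- a vertex of degree at most one); in the orientation following the list no
-- edge of S is flippable (`short⇒not-guarding`).

open import Level using (Level)
open import Function using (_∘_)
open import Data.Empty using (⊥; ⊥-elim)
open import Data.Unit using (tt)
open import Data.Bool using (true; false; not; T)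
open import Data.Product using (_×_; _,_; proj₁; proj₂; ∃₂; ∃-syntax)
open import Data.Product.Properties using (≡-dec)
open import Data.Sum as Sum using (_⊎_; inj₁; inj₂)
open import Data.Nat using (ℕ; zero; suc; _+_; _*_; _∸_; _≤_; _<_; _<ᵇ_; ∣_-_∣; z≤n; s≤s; z<s; s<s)
open import Data.Nat.Properties hiding (_≟_)
open import Data.Fin using (Fin; zero; suc) renaming (_<_ to _<ᶠ_)
open import Data.Fin.Properties as Fin using (_≟_)
  renaming (<-cmp to <ᶠ-cmp; <-irrelevant to <ᶠ-irrelevant; <-asym to <ᶠ-asym; <-irrefl to <ᶠ-irrefl)
open import Data.List using (List; []; _∷_; _++_; length; filter; map; allFin)
open import Data.List.Properties using (length-map; length-tabulate)
open import Data.List.Extrema.Nat using (argmin; f[argmin]≤f[xs])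
open import Data.List.Membership.Propositional using (_∈_; _∉_; lose; find)
open import Data.List.Membership.Propositional.Properties using (∈-allFin; ∈-map⁺; ∈-filter⁺; ∈-∃++)
open import Data.List.Relation.Unary.Any using (here; there)
open import Data.List.Relation.Unary.All as All using (All; _∷_)
open import Data.List.Relation.Unary.AllPairs as AllPairs using (_∷_)
open import Data.List.Relation.Unary.Linked as Linked using (Linked; []; [-]; _∷_)
open import Data.List.Relation.Unary.Unique.Propositional using (Unique)
open import Data.List.Relation.Unary.Unique.Propositional.Properties using (map⁺; allFin⁺)
open import Data.List.Relation.Binary.Permutation.Propositional
  using (_↭_; ↭-refl; ↭-sym; ↭-trans; ↭⇒↭ₛ; prep; swap)
open import Data.List.Relation.Binary.Permutation.Propositional.Properties using (shift; ↭-length; ∈-resp-↭)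
import Data.List.Relation.Binary.Permutation.Setoid.Properties as SetoidPermutation
open import Relation.Nullary using (¬_; Dec; yes; no; contradiction)
open import Relation.Nullary.Decidable using (_×-dec_; _⊎-dec_; map′)
open import Relation.Unary using (Pred; Decidable)
open import Relation.Unary.Properties using (∁?)
open import Relation.Binary.Definitions using (DecidableEquality; tri<; tri≈; tri>)
open import Relation.Binary.PropositionalEquality
  using (_≡_; _≢_; refl; sym; trans; cong; subst; subst₂; ≢-sym; setoid)
open import Defs

count : {A : Set} {ℓ : Level} {P : Pred A ℓ} → Decidable P → List A → ℕ
count P? xs = length (filter P? xs)

module _ {A : Set} {ℓ : Level} {P Q : Pred A ℓ} (P? : Decidable P) (Q? : Decidable Q) where

  count-mono : (∀ {y} → P y → Q y) → (xs : List A) → count P? xs ≤ count Q? xs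
  count-mono P⊆Q [] = z≤n
  count-mono P⊆Q (y ∷ ys) with P? y | Q? y
  ... | yes _  | yes _  = s≤s (count-mono P⊆Q ys)
  ... | yes py | no ¬qy = contradiction (P⊆Q py) ¬qy
  ... | no _   | yes _  = m≤n⇒m≤1+n (count-mono P⊆Q ys)
  ... | no _   | no _   = count-mono P⊆Q ys

  count-strict : (∀ {y} → P y → Q y) → ∀ {x} → Q x → ¬ P x →
                 (xs : List A) → x ∈ xs → count P? xs < count Q? xs
  count-strict P⊆Q {x} qx ¬px (y ∷ ys) x∈ with P? y | Q? y | x∈
  ... | yes py | no ¬qy | _          = contradiction (P⊆Q py) ¬qy
  ... | yes py | yes _  | here refl  = contradiction py ¬px
  ... | no _   | no ¬qy | here refl  = contradiction qx ¬qy
  ... | no _   | yes _  | here refl  = s≤s (count-mono P⊆Q ys)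
  ... | yes _  | yes _  | there x∈ys = s≤s (count-strict P⊆Q qx ¬px ys x∈ys)
  ... | no _   | yes _  | there x∈ys = m≤n⇒m≤1+n (count-strict P⊆Q qx ¬px ys x∈ys)
  ... | no _   | no _   | there x∈ys = count-strict P⊆Q qx ¬px ys x∈ys

  count-without : (∀ {y} → P y → ¬ Q y) → (xs : List A) →
                  count P? (filter (∁? Q?) xs) ≡ count P? xs
  count-without disjoint [] = refl
  count-without disjoint (y ∷ ys) with Q? y
  ... | no _ with P? y
  ...   | yes _ = cong suc (count-without disjoint ys)
  ...   | no _  = count-without disjoint ys
  count-without disjoint (y ∷ ys) | yes qy with P? y
  ...   | yes py = contradiction qy (disjoint py)
  ...   | no _   = count-without disjoint ys

length-split : {A : Set} {ℓ : Level} {P : Pred A ℓ} (P? : Decidable P) (xs : List A) →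
               length xs ≡ count P? xs + count (∁? P?) xs
length-split P? [] = refl
length-split P? (y ∷ ys) with P? y
... | yes _ = cong suc (length-split P? ys)
... | no _  = trans (cong suc (length-split P? ys)) (sym (+-suc _ _))

closer : ∀ {s t w} → (s < w × w < t) ⊎ (t < w × w < s) → ∣ w - s ∣ < ∣ t - s ∣
closer {s} {t} {w} (inj₁ (s<w , w<t)) =
  subst₂ _<_ (sym (m≤n⇒∣n-m∣≡n∸m (<⇒≤ s<w)))
             (sym (m≤n⇒∣n-m∣≡n∸m (<⇒≤ (<-trans s<w w<t))))
         (∸-monoˡ-< w<t (<⇒≤ s<w))
closer {s} {t} {w} (inj₂ (t<w , w<s)) =
  subst₂ _<_ (sym (m≤n⇒∣m-n∣≡n∸m (<⇒≤ w<s)))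
             (sym (m≤n⇒∣m-n∣≡n∸m (<⇒≤ (<-trans t<w w<s))))
         (∸-monoʳ-< t<w (<⇒≤ w<s))

-- Doubling leaves a free odd value between two distinct numbers.
suc-double-< : ∀ {m n} → m < n → suc (2 * m) < 2 * n
suc-double-< {m} {n} m<n = subst (_≤ 2 * n) (*-suc 2 m) (*-monoʳ-≤ 2 m<n)

private variable
  n : ℕ
  o : Orientation n
  e : Edge n
  f : Fin n → ℕ
  a b i j w x y : Fin n

-- Every edge {i , j} of K_n carries exactly one arc, so arcs are irreflexive
-- and antisymmetric and any two distinct vertices are joined by an arc.
arc-irreflexive : ¬ Arc o x x
arc-irreflexive (fwd _ _ p _) = <ᶠ-irrefl refl p
arc-irreflexive (bwd _ _ p _) = <ᶠ-irrefl refl p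

arc-distinct : Arc o x y → x ≢ y
arc-distinct xy refl = arc-irreflexive xy

-- (The value of an orientation on an edge ignores the proof of i < j.)
arc-antisym : Arc o x y → ¬ Arc o y x
arc-antisym {o = o} (fwd x y p h) (bwd _ _ q h′) =
  contradiction (trans (sym h) (trans (cong (λ r → o ((x , y) , r)) (<ᶠ-irrelevant p q)) h′)) λ ()
arc-antisym {o = o} (bwd y x p h) (fwd _ _ q h′) =
  contradiction (trans (sym h′) (trans (cong (λ r → o ((y , x) , r)) (<ᶠ-irrelevant q p)) h)) λ ()
arc-antisym (fwd _ _ p _) (fwd _ _ q _) = <ᶠ-asym p q
arc-antisym (bwd _ _ p _) (bwd _ _ q _) = <ᶠ-asym p q

orient : (o : Orientation n) (p : i <ᶠ j) → Arc o i j ⊎ Arc o j i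
orient {i = i} {j} o p with o ((i , j) , p) in eq
... | true  = inj₁ (fwd i j p eq)
... | false = inj₂ (bwd i j p eq)

arc-total : (o : Orientation n) → x ≢ y → Arc o x y ⊎ Arc o y x
arc-total {x = x} {y} o x≢y with <ᶠ-cmp x y
... | tri< p _ _ = orient o p
... | tri≈ _ x≡y _ = contradiction x≡y x≢y
... | tri> _ _ p with orient o p
...   | inj₁ yx = inj₂ yx
...   | inj₂ xy = inj₁ xy

data Joins : Edge n → Fin n → Fin n → Set where
  forward  : {p : i <ᶠ j} → Joins ((i , j) , p) i j
  backward : {p : i <ᶠ j} → Joins ((i , j) , p) j i

joins? : (e : Edge n) (x y : Fin n) → Dec (Joins e x y)
joins? ((i , j) , _) x y =
  map′ from-equalities to-equalities ((x ≟ i ×-dec y ≟ j) ⊎-dec (x ≟ j ×-dec y ≟ i))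
  where
    from-equalities : (x ≡ i × y ≡ j) ⊎ (x ≡ j × y ≡ i) → Joins ((i , j) , _) x y
    from-equalities (inj₁ (refl , refl)) = forward
    from-equalities (inj₂ (refl , refl)) = backward
    to-equalities : Joins ((i , j) , _) x y → (x ≡ i × y ≡ j) ⊎ (x ≡ j × y ≡ i)
    to-equalities forward  = inj₁ (refl , refl)
    to-equalities backward = inj₂ (refl , refl)

joins-sym : Joins e x y → Joins e y x
joins-sym forward  = backward
joins-sym backward = forward

joins-other : Joins e a b → Joins e a w → w ≡ b
joins-other forward        forward  = refl
joins-other backward       backward = refl
joins-other (forward {p = p}) backward = contradiction p (<ᶠ-irrefl refl)
joins-other (backward {p = p}) forward = contradiction p (<ᶠ-irrefl refl)

joins-cases : Joins e a b → Joins e x y → (x ≡ a × y ≡ b) ⊎ (x ≡ b × y ≡ a)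
joins-cases forward  forward  = inj₁ (refl , refl)
joins-cases forward  backward = inj₂ (refl , refl)
joins-cases backward forward  = inj₂ (refl , refl)
joins-cases backward backward = inj₁ (refl , refl)

edge-arc : (o : Orientation n) (e : Edge n) → ∃₂ λ a b → Joins e a b × Arc o a b
edge-arc o ((i , j) , p) with orient o p
... | inj₁ ij = i , j , forward , ij
... | inj₂ ji = j , i , backward , ji

flip-same : (o : Orientation n) (p q : i <ᶠ j) →
            flipEdge o ((i , j) , p) ((i , j) , q) ≡ not (o ((i , j) , q))
flip-same {i = i} {j} o p q with i ≟ i | j ≟ j
... | yes _   | yes _   = refl
... | no i≢i  | _       = contradiction refl i≢i
... | yes _   | no j≢j  = contradiction refl j≢j

flip-other : (o : Orientation n) (p : i <ᶠ j) (q : a <ᶠ b) → ¬ (a ≡ i × b ≡ j) →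
             flipEdge o ((i , j) , p) ((a , b) , q) ≡ o ((a , b) , q)
flip-other {i = i} {j} {a} {b} o p q ¬same with a ≟ i | b ≟ j
... | yes a≡i | yes b≡j = contradiction (a≡i , b≡j) ¬same
... | yes _   | no _    = refl
... | no _    | yes _   = refl
... | no _    | no _    = refl

flip-keep : ¬ Joins e x y → Arc o x y → Arc (flipEdge o e) x y
flip-keep {e = (i , j) , p} {o = o} ¬e (fwd x y q h) =
  fwd x y q (trans (flip-other o p q λ { (refl , refl) → ¬e forward }) h)
flip-keep {e = (i , j) , p} {o = o} ¬e (bwd y x q h) =
  bwd y x q (trans (flip-other o p q λ { (refl , refl) → ¬e backward }) h)

flip-reverse : Joins e x y → Arc o y x → Arc (flipEdge o e) x y
flip-reverse {o = o} (forward {p = p})  (bwd i j q h) = fwd i j q (trans (flip-same o p q) (cong not h))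
flip-reverse {o = o} (backward {p = p}) (fwd i j q h) = bwd i j q (trans (flip-same o p q) (cong not h))
flip-reverse (forward {p = p})  (fwd _ _ q _) = contradiction q (<ᶠ-asym p)
flip-reverse (backward {p = p}) (bwd _ _ q _) = contradiction q (<ᶠ-asym p)

flip-arc : Arc (flipEdge o e) x y → (¬ Joins e x y × Arc o x y) ⊎ (Joins e x y × Arc o y x)
flip-arc {o = o} {e = e} {x = x} {y} xy with joins? e x y | arc-total o (arc-distinct xy)
... | no ¬e | inj₁ xy′ = inj₁ (¬e , xy′)
... | no ¬e | inj₂ yx  = contradiction (flip-keep (¬e ∘ joins-sym) yx) (arc-antisym xy)
... | yes j | inj₁ xy′ = contradiction (flip-reverse (joins-sym j) xy′) (arc-antisym xy)
... | yes j | inj₂ yx  = inj₂ (j , yx)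

Potential : Orientation n → (Fin n → ℕ) → Set
Potential o f = ∀ {x y} → Arc o x y → f x < f y

walk-increases : Potential o f → Walk o x y → f x < f y
walk-increases pot (one xy)       = pot xy
walk-increases pot (step xw walk) = <-trans (pot xw) (walk-increases pot walk)

potential⇒acyclic : Potential o f → Acyclic o
potential⇒acyclic pot v cycle = <-irrefl refl (walk-increases pot cycle)

-- Since every pair of vertices carries an arc, a potential determines the
-- orientation and is injective.
potential-arc : Potential o f → x ≢ y → f x < f y → Arc o x y
potential-arc {o = o} pot x≢y fx<fy with arc-total o x≢y
... | inj₁ xy = xy
... | inj₂ yx = contradiction fx<fy (<-asym (pot yx))

potential-injective : Potential o f → x ≢ y → f x ≢ f y
potential-injective {o = o} pot x≢y with arc-total o x≢y
... | inj₁ xy = <⇒≢ (pot xy)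
... | inj₂ yx = ≢-sym (<⇒≢ (pot yx))

-- If a vertex w lies strictly between the ends of the arc a → b on e, then
-- flipping e closes the directed triangle a → w → b → a.
between⇒not-flippable : Potential o f → Joins e a b → Arc o a b →
                        f a < f w → f w < f b → ¬ Flippable o e
between⇒not-flippable {o = o} {e = e} {a = a} {b = b} {w = w} pot ab∈e ab fa<fw fw<fb flippable =
  flippable a (step a→w (step w→b (one b→a)))
  where
    w≢a : w ≢ a
    w≢a refl = <-irrefl refl fa<fw
    w≢b : w ≢ b
    w≢b refl = <-irrefl refl fw<fb
    a→w : Arc (flipEdge o e) a w
    a→w = flip-keep (λ aw∈e → w≢b (joins-other ab∈e aw∈e))
                    (potential-arc pot (w≢a ∘ sym) fa<fw)
    w→b : Arc (flipEdge o e) w b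
    w→b = flip-keep (λ wb∈e → w≢a (joins-other (joins-sym ab∈e) (joins-sym wb∈e)))
                    (potential-arc pot w≢b fw<fb)
    b→a : Arc (flipEdge o e) b a
    b→a = flip-reverse (joins-sym ab∈e) ab

-- If no vertex lies strictly between the ends of the arc a → b on e, then e
-- is flippable: doubling f and lifting a just above b is a potential for the
-- flipped orientation.
adjacent⇒flippable : Potential o f → Joins e a b → Arc o a b →
                     (∀ w → f a < f w → f w < f b → ⊥) → Flippable o e
adjacent⇒flippable {o = o} {f = f} {e = e} {a = a} {b = b} pot ab∈e ab gap =
  potential⇒acyclic raised-potential
  where
    raised : Fin _ → ℕ
    raised x with x ≟ a
    ... | yes _ = suc (2 * f b)
    ... | no _  = 2 * f x

    raised-a : raised a ≡ suc (2 * f b)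
    raised-a with a ≟ a
    ... | yes _   = refl
    ... | no a≢a  = contradiction refl a≢a

    raised-other : x ≢ a → raised x ≡ 2 * f x
    raised-other {x} x≢a with x ≟ a
    ... | yes x≡a = contradiction x≡a x≢a
    ... | no _    = refl

    beyond : y ≢ b → f a < f y → f b < f y
    beyond y≢b fa<fy = ≤∧≢⇒< (≮⇒≥ (gap _ fa<fy)) (potential-injective pot (y≢b ∘ sym))

    raised-potential : Potential (flipEdge o e) raised
    raised-potential {x} {y} xy with flip-arc xy
    ... | inj₂ (xy∈e , yx) with joins-cases ab∈e xy∈e
    ...   | inj₁ (refl , refl) = contradiction yx (arc-antisym ab)
    ...   | inj₂ (refl , refl) = subst₂ _<_ (sym (raised-other (arc-distinct ab ∘ sym))) (sym raised-a)
                                        (n<1+n (2 * f b))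
    raised-potential {x} {y} xy | inj₁ (¬xy∈e , xy′) with x ≟ a | y ≟ a
    ... | yes refl | yes refl = contradiction xy′ arc-irreflexive
    ... | yes refl | no _ = suc-double-< (beyond (λ { refl → ¬xy∈e ab∈e }) (pot xy′))
    ... | no _     | yes refl = m≤n⇒m≤1+n (*-monoʳ-< 2 (<-trans (pot xy′) (pot ab)))
    ... | no _     | no _     = *-monoʳ-< 2 (pot xy′)

arc? : (o : Orientation n) (x y : Fin n) → Dec (Arc o x y)
arc? o x y with x ≟ y
... | yes refl = no arc-irreflexive
... | no x≢y with arc-total o x≢y
...   | inj₁ xy = yes xy
...   | inj₂ yx = no (arc-antisym yx)

-- In an acyclic orientation of K_n the arcs form a transitive relation:
-- otherwise the arc between the outer vertices would close a cycle.
arc-trans : Acyclic o → Arc o x w → Arc o w y → Arc o x y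
arc-trans {o = o} {x = x} {y = y} acyclic xw wy with x ≟ y
... | yes refl = contradiction (step xw (one wy)) (acyclic x)
... | no x≢y with arc-total o x≢y
...   | inj₁ xy = xy
...   | inj₂ yx = contradiction (step xw (step wy (one yx))) (acyclic x)

rank : Orientation n → Fin n → ℕ
rank {n} o x = count (λ w → arc? o w x) (allFin n)

-- By transitivity an arc x → y makes every in-neighbour of x one of y, and
-- x itself is an extra one: the rank is a potential of an acyclic orientation.
rank-potential : Acyclic o → Potential o (rank o)
rank-potential {n} {o} acyclic {x} {y} xy =
  count-strict (λ w → arc? o w x) (λ w → arc? o w y) (λ wx → arc-trans acyclic wx xy)
               xy arc-irreflexive (allFin n) (∈-allFin x)

star : (m : ℕ) → List (Edge (2 + m))
star m = map (λ k → (zero , suc k) , z<s) (allFin (suc m))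

star-unique : (m : ℕ) → Unique (star m)
star-unique m = map⁺ (λ eq → Fin.suc-injective (cong (proj₂ ∘ proj₁) eq)) (allFin⁺ (suc m))

star-length : (m : ℕ) → length (star m) ≡ suc m
star-length m = trans (length-map _ (allFin (suc m))) (length-tabulate (λ k → k))

-- The star guards K_(2+m): in an acyclic orientation take the neighbour
-- k+1 of 0 whose rank is closest to that of 0; no rank lies strictly between
-- theirs, so the edge {0 , k+1} is flippable.
star-guarding : (m : ℕ) → Guarding (star m)
star-guarding m o acyclic = lose (∈-map⁺ _ (∈-allFin k)) (flippable (edge-arc o spoke))
  where
    rk : Fin (2 + m) → ℕ
    rk = rank o
    distance : Fin (suc m) → ℕ
    distance k = ∣ rk (suc k) - rk zero ∣
    k : Fin (suc m)
    k = argmin distance zero (allFin (suc m))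
    spoke : Edge (2 + m)
    spoke = (zero , suc k) , z<s

    minimal : ∀ k′ → distance k ≤ distance k′
    minimal k′ = All.lookup (f[argmin]≤f[xs] {f = distance} zero (allFin (suc m))) (∈-allFin k′)

    no-rank-between : ∀ w → (rk zero < rk w × rk w < rk (suc k)) ⊎ (rk (suc k) < rk w × rk w < rk zero) →
                      ⊥
    no-rank-between zero     (inj₁ (f0<f0 , _)) = <-irrefl refl f0<f0
    no-rank-between zero     (inj₂ (_ , f0<f0)) = <-irrefl refl f0<f0
    no-rank-between (suc k′) between            = <⇒≱ (closer between) (minimal k′)

    flippable : (∃₂ λ a b → Joins spoke a b × Arc o a b) → Flippable o spoke
    flippable (_ , _ , ab∈e@forward , ab) =
      adjacent⇒flippable (rank-potential acyclic) ab∈e ab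
                         (λ w 0<w w<k → no-rank-between w (inj₁ (0<w , w<k)))
    flippable (_ , _ , ab∈e@backward , ab) =
      adjacent⇒flippable (rank-potential acyclic) ab∈e ab
                         (λ w k<w w<0 → no-rank-between w (inj₂ (k<w , w<0)))

module Arrangement {V : Set} (_≟ᵛ_ : DecidableEquality V) where

  private variable
    v : V
    P Q L : List V

  Pair : Set
  Pair = V × V

  _≟ₚ_ : DecidableEquality Pair
  _≟ₚ_ = ≡-dec _≟ᵛ_ _≟ᵛ_

  Joined : List Pair → V → V → Set
  Joined S x y = (x , y) ∈ S ⊎ (y , x) ∈ S

  joined-sym : ∀ {S x y} → Joined S x y → Joined S y x
  joined-sym = Sum.swap

  Separates : List Pair → List V → Set
  Separates S = Linked (λ x y → ¬ Joined S x y)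

  Arrangement : List Pair → List V → Set
  Arrangement S L = ∃[ P ] (P ↭ L × Separates S P)

  separates-[] : (P : List V) → Separates [] P
  separates-[] []          = []
  separates-[] (_ ∷ [])    = [-]
  separates-[] (_ ∷ y ∷ P) = (λ { (inj₁ ()) ; (inj₂ ()) }) ∷ separates-[] (y ∷ P)

  separates-weaken : ∀ {S S′} → (∀ {x y} → x ∈ P → y ∈ P → Joined S x y → Joined S′ x y) →
                     Separates S′ P → Separates S P
  separates-weaken S⇒S′ []            = []
  separates-weaken S⇒S′ [-]           = [-]
  separates-weaken S⇒S′ (¬xy ∷ sep) =
    (¬xy ∘ S⇒S′ (here refl) (there (here refl))) ∷
    separates-weaken (λ x∈ y∈ → S⇒S′ (there x∈) (there y∈)) sep

  unique-↭ : P ↭ Q → Unique P → Unique Q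
  unique-↭ P↭Q = PermutationProperties.Unique-resp-↭ (↭⇒↭ₛ P↭Q)
    where module PermutationProperties = SetoidPermutation (setoid V)

  ∉⇒≢ : ∀ {x} → v ∉ L → x ∈ L → x ≢ v
  ∉⇒≢ v∉L x∈L refl = v∉L x∈L

  pos : V → List V → ℕ
  pos x [] = 0
  pos x (z ∷ r) with x ≟ᵛ z
  ... | yes _ = 0
  ... | no _  = suc (pos x r)

  pos-head : ∀ {z r} → pos z (z ∷ r) ≡ 0
  pos-head {z} with z ≟ᵛ z
  ... | yes _   = refl
  ... | no z≢z  = contradiction refl z≢z

  pos-tail : ∀ {x z r} → x ≢ z → pos x (z ∷ r) ≡ suc (pos x r)
  pos-tail {x} {z} x≢z with x ≟ᵛ z
  ... | yes x≡z = contradiction x≡z x≢z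
  ... | no _    = refl

  pos-injective : ∀ {x y} → x ∈ P → y ∈ P → pos x P ≡ pos y P → x ≡ y
  pos-injective {z ∷ r} {x} {y} x∈ y∈ eq with x ≟ᵛ z | y ≟ᵛ z
  ... | yes refl | yes refl = refl
  ... | no x≢z   | no y≢z   = pos-injective (tail-∈ x≢z x∈) (tail-∈ y≢z y∈) (suc-injective eq)
    where
      tail-∈ : ∀ {u} → u ≢ z → u ∈ z ∷ r → u ∈ r
      tail-∈ u≢z (here u≡z) = contradiction u≡z u≢z
      tail-∈ u≢z (there u∈) = u∈

  between : ∀ {S x y} → Unique P → Separates S P → x ∈ P → y ∈ P →
            pos x P < pos y P → Joined S x y → ∃[ w ] (w ∈ P × pos x P < pos w P × pos w P < pos y P)
  between {z ∷ r} _ _ (here refl) (here refl) lt _ = contradiction lt (<-irrefl refl)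
  between {z ∷ r} {x = x} _ _ (there _) (here refl) lt _ =
    contradiction (subst (pos x (z ∷ r) <_) pos-head lt) n≮0
  between {z ∷ z′ ∷ r} _ (¬zz′ ∷ _) (here refl) (there (here refl)) _ zz′ = contradiction zz′ ¬zz′
  between {z ∷ z′ ∷ r} {y = y} ((z≢z′ ∷ z≢r) ∷ (z′∉r ∷ _)) _ (here refl) (there (there y∈r)) _ _ =
    z′ , there (here refl) , first<second , second<y
    where
      first<second : pos z (z ∷ z′ ∷ r) < pos z′ (z ∷ z′ ∷ r)
      first<second rewrite pos-head {z} {z′ ∷ r} | pos-tail {r = z′ ∷ r} (z≢z′ ∘ sym) = z<s
      second<y : pos z′ (z ∷ z′ ∷ r) < pos y (z ∷ z′ ∷ r)
      second<y rewrite pos-tail {r = z′ ∷ r} (z≢z′ ∘ sym) | pos-head {z′} {r}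
                     | pos-tail {r = z′ ∷ r} (All.lookup z≢r y∈r ∘ sym)
                     | pos-tail {r = r} (All.lookup z′∉r y∈r ∘ sym) = s<s z<s
  between {z ∷ r} {x = x} {y} (z≢r ∷ u) sep (there x∈r) (there y∈r) lt xy =
    let w , w∈r , x<w , w<y = between u (Linked.tail sep) x∈r y∈r
                                 (≤-pred (subst₂ _<_ (shifted x∈r) (shifted y∈r) lt)) xy
    in w , there w∈r , subst₂ _<_ (sym (shifted x∈r)) (sym (shifted w∈r)) (s<s x<w)
                     , subst₂ _<_ (sym (shifted w∈r)) (sym (shifted y∈r)) (s<s w<y)
    where
      shifted : ∀ {t} → t ∈ r → pos t (z ∷ r) ≡ suc (pos t r)
      shifted t∈r = pos-tail (All.lookup z≢r t∈r ∘ sym)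

  ends : List Pair → List V
  ends []             = []
  ends ((a , b) ∷ S) = a ∷ b ∷ ends S

  ends-length : (S : List Pair) → length (ends S) ≡ length S + length S
  ends-length []             = refl
  ends-length ((a , b) ∷ S) =
    cong suc (trans (cong suc (ends-length S)) (sym (+-suc (length S) (length S))))

  occurrences : V → List V → ℕ
  occurrences v = count (_≟ᵛ v)

  -- Pigeonhole: if E has fewer than 2|L| entries, some entry of the
  -- duplicate-free list L occurs at most once in E. (Otherwise remove all
  -- occurrences of the head of L from E and recurse on the tail.)
  rare-entry : Unique L → (E : List V) → length E < length L + length L →
               ∃[ v ] (v ∈ L × occurrences v E ≤ 1)
  rare-entry {x ∷ L} (x≢L ∷ u) E short with occurrences x E ≤? 1
  ... | yes rare = x , here refl , rare
  ... | no often =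
    let v , v∈L , rare = rare-entry u (filter (∁? (_≟ᵛ x)) E) shorter
    in v , there v∈L , subst (_≤ 1) (count-without (_≟ᵛ v) (_≟ᵛ x) (disjoint v∈L) E) rare
    where
      shorter : length (filter (∁? (_≟ᵛ x)) E) < length L + length L
      shorter = ≤-pred (≤-pred (begin-strict
        2 + length (filter (∁? (_≟ᵛ x)) E)               ≤⟨ +-monoˡ-≤ _ (≰⇒> often) ⟩
        occurrences x E + length (filter (∁? (_≟ᵛ x)) E) ≡⟨ length-split (_≟ᵛ x) E ⟨
        length E                                         <⟨ short ⟩
        suc (length L) + suc (length L)                  ≡⟨ cong suc (+-suc (length L) (length L)) ⟩
        2 + (length L + length L)                        ∎))
        where open ≤-Reasoning
      disjoint : ∀ {v y} → v ∈ L → y ≡ v → y ≢ x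
      disjoint v∈L refl refl = All.lookup x≢L v∈L refl

  Touches : V → Pair → Set
  Touches v (a , b) = a ≡ v ⊎ b ≡ v

  touches? : (v : V) → Decidable (Touches v)
  touches? v (a , b) = (a ≟ᵛ v) ⊎-dec (b ≟ᵛ v)

  away : V → List Pair → List Pair
  away v = filter (∁? (touches? v))

  touching≤occurrences : (S : List Pair) → count (touches? v) S ≤ occurrences v (ends S)
  touching≤occurrences [] = z≤n
  touching≤occurrences {v} ((a , b) ∷ S) with a ≟ᵛ v
  ... | yes _ with b ≟ᵛ v
  ...   | yes _ = s≤s (m≤n⇒m≤1+n (touching≤occurrences S))
  ...   | no _  = s≤s (touching≤occurrences S)
  touching≤occurrences {v} ((a , b) ∷ S) | no _ with b ≟ᵛ v
  ...   | yes _ = s≤s (touching≤occurrences S)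
  ...   | no _  = touching≤occurrences S

  partner : V → Pair → V
  partner v (a , b) with a ≟ᵛ v
  ... | yes _ = b
  ... | no _  = a

  partner-fst : ∀ {y} → partner v (v , y) ≡ y
  partner-fst {v} with v ≟ᵛ v
  ... | yes _   = refl
  ... | no v≢v  = contradiction refl v≢v

  partner-snd : ∀ {y} → partner v (y , v) ≡ y
  partner-snd {v} {y} with y ≟ᵛ v
  ... | yes y≡v = sym y≡v
  ... | no _    = refl

  data Sparse (v : V) (S : List Pair) : Set where
    isolated : (∀ {y} → ¬ Joined S v y) → Sparse v S
    pendant  : (w : V) → (∀ {y} → Joined S v y → y ≡ w) →
               length S ≡ suc (length (away v S)) → Sparse v S

  sparse : (S : List Pair) → occurrences v (ends S) ≤ 1 → Sparse v S
  sparse {v} S rare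
    with filter (touches? v) S in touching | ≤-trans (touching≤occurrences S) rare
  ... | [] | _ = isolated (λ { (inj₁ vy∈S) → none (touching-∈ vy∈S (inj₁ refl))
                             ; (inj₂ yv∈S) → none (touching-∈ yv∈S (inj₂ refl)) })
    where
      none : ∀ {p} → p ∉ []
      none ()
      touching-∈ : ∀ {p} → p ∈ S → Touches v p → p ∈ []
      touching-∈ p∈S vp = subst (_ ∈_) touching (∈-filter⁺ (touches? v) p∈S vp)
  ... | p ∷ [] | _ = pendant (partner v p) only-partner
                       (trans (length-split (touches? v) S) (cong (λ T → length T + length (away v S)) touching))
    where
      touching-∈ : ∀ {q} → q ∈ S → Touches v q → q ≡ p
      touching-∈ q∈S vq with subst (_ ∈_) touching (∈-filter⁺ (touches? v) q∈S vq)
      ... | here q≡p = q≡p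
      only-partner : ∀ {y} → Joined S v y → y ≡ partner v p
      only-partner (inj₁ vy∈S) with touching-∈ vy∈S (inj₁ refl)
      ... | refl = sym partner-fst
      only-partner (inj₂ yv∈S) with touching-∈ yv∈S (inj₂ refl)
      ... | refl = sym partner-snd
  ... | _ ∷ _ ∷ _ | s≤s ()

  separates-away : ∀ {S} → v ∉ P → Separates (away v S) P → Separates S P
  separates-away {v} {P} {S} v∉P = separates-weaken keep
    where
      keep : ∀ {x y} → x ∈ P → y ∈ P → Joined S x y → Joined (away v S) x y
      keep x∈ y∈ (inj₁ xy∈) = inj₁ (∈-filter⁺ (∁? (touches? v)) xy∈ Sum.[ ∉⇒≢ v∉P x∈ , ∉⇒≢ v∉P y∈ ])
      keep x∈ y∈ (inj₂ yx∈) = inj₂ (∈-filter⁺ (∁? (touches? v)) yx∈ Sum.[ ∉⇒≢ v∉P y∈ , ∉⇒≢ v∉P x∈ ])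

  -- Placing a vertex v isolated in S = (a , b) ∷ S₀ into an arrangement
  -- separating S₀: put v between a and b where they are adjacent (or at the
  -- end if they never are). `after x r` is the new tail following the entry x.
  module Isolated (v a b : V) (S₀ : List Pair) (v-isolated : ∀ {y} → ¬ Joined ((a , b) ∷ S₀) v y) where

    private
      S : List Pair
      S = (a , b) ∷ S₀

    after : V → List V → List V
    after x []      = v ∷ []
    after x (y ∷ r) with ((x , y) ≟ₚ (a , b)) ⊎-dec ((y , x) ≟ₚ (a , b))
    ... | yes _ = v ∷ y ∷ r
    ... | no _  = y ∷ after y r

    insert : List V → List V
    insert []      = v ∷ []
    insert (x ∷ r) = x ∷ after x r

    after-↭ : ∀ x r → after x r ↭ v ∷ r
    after-↭ x []      = ↭-refl
    after-↭ x (y ∷ r) with ((x , y) ≟ₚ (a , b)) ⊎-dec ((y , x) ≟ₚ (a , b))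
    ... | yes _ = ↭-refl
    ... | no _  = ↭-trans (prep y (after-↭ y r)) (swap y v ↭-refl)

    insert-↭ : ∀ P → insert P ↭ v ∷ P
    insert-↭ []      = ↭-refl
    insert-↭ (x ∷ r) = ↭-trans (prep x (after-↭ x r)) (swap x v ↭-refl)

    separates-cons : ∀ {Q} → a ∉ Q ⊎ b ∉ Q → Separates S₀ Q → Separates S Q
    separates-cons {Q} missing = separates-weaken drop-ab
      where
        drop-ab : ∀ {x y} → x ∈ Q → y ∈ Q → Joined S x y → Joined S₀ x y
        drop-ab x∈ y∈ (inj₁ (here refl)) = ⊥-elim (Sum.[ (λ a∉ → a∉ x∈) , (λ b∉ → b∉ y∈) ] missing)
        drop-ab x∈ y∈ (inj₂ (here refl)) = ⊥-elim (Sum.[ (λ a∉ → a∉ y∈) , (λ b∉ → b∉ x∈) ] missing)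
        drop-ab x∈ y∈ (inj₁ (there xy∈)) = inj₁ xy∈
        drop-ab x∈ y∈ (inj₂ (there yx∈)) = inj₂ yx∈

    after-separates : ∀ x r → Unique (x ∷ r) → Separates S₀ (x ∷ r) → Separates S (x ∷ after x r)
    after-separates x [] _ _ = (v-isolated ∘ joined-sym) ∷ [-]
    after-separates x (y ∷ r) (x≢yr ∷ u) (¬xy ∷ sep)
      with ((x , y) ≟ₚ (a , b)) ⊎-dec ((y , x) ≟ₚ (a , b))
    ... | yes xy≡ab = (v-isolated ∘ joined-sym) ∷ v-isolated ∷ separates-cons (missing xy≡ab) sep
      where
        x∉yr : x ∉ y ∷ r
        x∉yr x∈ = All.lookup x≢yr x∈ refl
        missing : (x , y) ≡ (a , b) ⊎ (y , x) ≡ (a , b) → a ∉ y ∷ r ⊎ b ∉ y ∷ r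
        missing (inj₁ refl) = inj₁ x∉yr
        missing (inj₂ refl) = inj₂ x∉yr
    ... | no xy≢ab = ¬xy′ ∷ after-separates y r u sep
      where
        ¬xy′ : ¬ Joined S x y
        ¬xy′ (inj₁ (here xy≡ab)) = xy≢ab (inj₁ xy≡ab)
        ¬xy′ (inj₂ (here yx≡ab)) = xy≢ab (inj₂ yx≡ab)
        ¬xy′ (inj₁ (there xy∈))  = ¬xy (inj₁ xy∈)
        ¬xy′ (inj₂ (there yx∈))  = ¬xy (inj₂ yx∈)

    insert-separates : Unique P → Separates S₀ P → Separates S (insert P)
    insert-separates {[]}    _ _   = [-]
    insert-separates {x ∷ r} u sep = after-separates x r u sep

    arrangement : Unique L → Arrangement S₀ L → Arrangement S (v ∷ L)
    arrangement uL (P , P↭L , sep) =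
      insert P , ↭-trans (insert-↭ P) (prep v P↭L) , insert-separates (unique-↭ (↭-sym P↭L) uL) sep

  -- Placing a vertex v whose only partner in S is w into an arrangement
  -- separating S (with at least two entries): in front, unless the front
  -- entry is w; then right after the second entry, which is not w.
  module Pendant (v w : V) (S : List Pair) (only-w : ∀ {y} → Joined S v y → y ≡ w) where

    place : List V → List V
    place (x ∷ y ∷ r) with x ≟ᵛ w
    ... | yes _ = x ∷ y ∷ v ∷ r
    ... | no _  = v ∷ x ∷ y ∷ r
    place P = v ∷ P

    place-↭ : ∀ P → place P ↭ v ∷ P
    place-↭ []          = ↭-refl
    place-↭ (x ∷ [])    = ↭-refl
    place-↭ (x ∷ y ∷ r) with x ≟ᵛ w
    ... | yes _ = ↭-trans (prep x (swap y v ↭-refl)) (swap x v ↭-refl)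
    ... | no _  = ↭-refl

    place-separates : Unique P → 2 ≤ length P → Separates S P → Separates S (place P)
    place-separates {_ ∷ []} _ (s≤s ()) _
    place-separates {x ∷ y ∷ r} ((x≢y ∷ x≢r) ∷ _) _ (¬xy ∷ sep) with x ≟ᵛ w
    ... | no x≢w   = (x≢w ∘ only-w) ∷ ¬xy ∷ sep
    ... | yes refl = ¬xy ∷ (x≢y ∘ sym ∘ only-w ∘ joined-sym) ∷ rest r x≢r (Linked.tail sep)
      where
        rest : ∀ r → All (w ≢_) r → Separates S r → Separates S (v ∷ r)
        rest []      _           _   = [-]
        rest (z ∷ _) (w≢z ∷ _)   sep = (w≢z ∘ sym ∘ only-w) ∷ sep

    arrangement : Unique L → v ∉ L → 2 ≤ length L → Arrangement (away v S) L → Arrangement S (v ∷ L)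
    arrangement uL v∉L two (P , P↭L , sep) =
      place P , ↭-trans (place-↭ P) (prep v P↭L) ,
      place-separates (unique-↭ (↭-sym P↭L) uL) (subst (2 ≤_) (sym (↭-length P↭L)) two)
                      (separates-away (v∉L ∘ ∈-resp-↭ P↭L) sep)

  fewer-ends : (S : List Pair) → 2 + length S ≤ length L → length (ends S) < length L + length L
  fewer-ends S room = subst (_< _) (sym (ends-length S))
                            (+-mono-< (≤-trans (n≤1+n _) room) (≤-trans (n≤1+n _) room))

  extract : v ∈ L → ∃[ L′ ] (L ↭ v ∷ L′)
  extract {v} v∈L with xs , ys , refl ← ∈-∃++ v∈L = xs ++ ys , shift v xs ys

  remove : Unique L → v ∈ L → ∃[ L′ ] (L ↭ v ∷ L′ × Unique L′ × v ∉ L′)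
  remove uL v∈L =
    let L′ , L↭vL′ = extract v∈L
        vL′-unique = unique-↭ L↭vL′ uL
    in L′ , L↭vL′ , AllPairs.tail vL′-unique , (λ v∈L′ → All.lookup (AllPairs.head vL′-unique) v∈L′ refl)

  reorder : ∀ {S L′} → L ↭ L′ → Arrangement S L → Arrangement S L′
  reorder L↭L′ (P , P↭L , sep) = P , ↭-trans P↭L L↭L′ , sep

  -- Take an entry u occurring at most once among
  -- the endpoints of S (it exists by `rare-entry`), arrange the rest L′ of L
  -- recursively, and place u back: if u is isolated, drop one pair (a , b)
  -- in the recursion and put u between a and b; if u has a single partner w,
  -- drop the pair touching u and put u away from w. (m bounds the recursion.)
  arrange : (m : ℕ) (L : List V) (S : List Pair) → length L ≡ m → Unique L →
            2 + length S ≤ length L → Arrangement S L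
  arrange _ L [] _ _ _ = L , ↭-refl , separates-[] L
  arrange zero L (_ ∷ _) len _ room = contradiction (subst (_ ≤_) len room) λ ()
  arrange (suc m) L S@((a , b) ∷ S₀) len uL room =
    reorder (↭-sym L↭uL′) (reinsert (sparse S rare))
    where
      found : ∃[ u ] (u ∈ L × occurrences u (ends S) ≤ 1)
      found = rare-entry uL (ends S) (fewer-ends {L = L} S room)
      u = proj₁ found
      rare = proj₂ (proj₂ found)
      removed = remove uL (proj₁ (proj₂ found))
      L′ = proj₁ removed
      L↭uL′ : L ↭ u ∷ L′
      L↭uL′ = proj₁ (proj₂ removed)
      L′-unique = proj₁ (proj₂ (proj₂ removed))
      u∉L′ = proj₂ (proj₂ (proj₂ removed))
      |L|≡ : length L ≡ suc (length L′)
      |L|≡ = ↭-length L↭uL′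
      |L′|≡m : length L′ ≡ m
      |L′|≡m = suc-injective (trans (sym |L|≡) len)

      reinsert : Sparse u S → Arrangement S (u ∷ L′)
      reinsert (isolated u-isolated) =
        Isolated.arrangement u a b S₀ u-isolated L′-unique
          (arrange m L′ S₀ |L′|≡m L′-unique (≤-pred (subst (2 + length S ≤_) |L|≡ room)))
      reinsert (pendant w only-w |S|≡) =
        Pendant.arrangement u w S only-w L′-unique u∉L′ (≤-trans (m≤m+n 2 _) room′)
          (arrange m L′ (away u S) |L′|≡m L′-unique room′)
        where
          room′ : 2 + length (away u S) ≤ length L′
          room′ = ≤-pred (subst₂ (λ k l → 2 + k ≤ l) |S|≡ |L|≡ room)

module _ {n : ℕ} where
  open Arrangement (_≟_ {n})

  ordered : List (Fin n) → Orientation n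
  ordered P ((i , j) , _) = pos i P <ᵇ pos j P

  ordered-potential : {P : List (Fin n)} → (∀ x → x ∈ P) → Potential (ordered P) (λ x → pos x P)
  ordered-potential covers (fwd i j _ h) = <ᵇ⇒< _ _ (subst T (sym h) tt)
  ordered-potential {P} covers (bwd i j i<j h) =
    ≤∧≢⇒< (≮⇒≥ (λ lt → subst T h (<⇒<ᵇ lt)))
          (λ eq → <ᶠ-irrefl (sym (pos-injective (covers j) (covers i) eq)) i<j)

  -- Fewer than n - 1 edges never guard K_n: list the vertices so that no
  -- edge of S joins two consecutive ones; in the induced orientation every
  -- edge of S has a vertex strictly between its ends, so none is flippable.
  short⇒not-guarding : (S : List (Edge n)) → 2 + length S ≤ n → ¬ Guarding S
  short⇒not-guarding S room guarding =
    let e , e∈S , flippable = find (guarding (ordered P) (potential⇒acyclic pot))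
    in stuck e∈S flippable
    where
      pairs : List (Fin n × Fin n)
      pairs = map proj₁ S
      arrangement : Arrangement pairs (allFin n)
      arrangement = arrange n (allFin n) pairs (length-tabulate (λ k → k)) (allFin⁺ n)
                      (subst₂ (λ k l → 2 + k ≤ l) (sym (length-map proj₁ S))
                              (sym (length-tabulate (λ k → k))) room)
      P = proj₁ arrangement
      P↭ = proj₁ (proj₂ arrangement)
      covers : ∀ x → x ∈ P
      covers x = ∈-resp-↭ (↭-sym P↭) (∈-allFin x)
      pot : Potential (ordered P) (λ x → pos x P)
      pot = ordered-potential covers

      joined : ∀ {e a b} → e ∈ S → Joins e a b → Joined pairs a b
      joined e∈S forward  = inj₁ (∈-map⁺ proj₁ e∈S)
      joined e∈S backward = inj₂ (∈-map⁺ proj₁ e∈S)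

      stuck : ∀ {e} → e ∈ S → ¬ Flippable (ordered P) e
      stuck {e} e∈S with a , b , ab∈e , ab ← edge-arc (ordered P) e
        with _ , _ , a<w , w<b ← between (unique-↭ (↭-sym P↭) (allFin⁺ n)) (proj₂ (proj₂ arrangement))
                                         (covers a) (covers b) (pot ab) (joined e∈S ab∈e)
        = between⇒not-flippable pot ab∈e ab a<w w<b

lemma1 : (n : ℕ) → 2 ≤ n → MinGuardingSize n (n ∸ 1)
lemma1 (suc (suc m)) (s≤s (s≤s z≤n)) = (star m , star-unique m , star-guarding m , star-length m) , at-least
  where
    at-least : (S : List (Edge (2 + m))) → Unique S → Guarding S → suc m ≤ length S
    at-least S _ guarding =
      ≮⇒≥ (λ short → short⇒not-guarding S (s≤s (s≤s (≤-pred short))) guarding)
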